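{- Let $\mathcal K(\cdot\,\|\,\cdot)$, $\mathcal K_{\min}(\cdot\,\|\,\cdot)$, $\mathcal K_{\max}(\cdot\,\|\,\cdot)$ be the functional Kolmogorov complexities defined from fixed optimal functionals in $PC(\{0,1\}^*\times P(\mathbb N)\to\mathbb X)$, $Min_{PC}(\{0,1\}^*\times P(\mathbb N)\to\mathbb N)$ and $Max_{PC}(\{0,1\}^*\times P(\mathbb N)\to\mathbb N)$ respectively. For every $A\subseteq\mathbb N$ there is a constant $c_A$ such that for all $x$: $|K^A(x)-\mathcal K(x\,\|\,A)|\le c_A$, $|K^A_{\min}(x)-\mathcal K_{\min}(x\,\|\,A)|\le c_A$, $|K^A_{\max}(x)-\mathcal K_{\max}(x\,\|\,A)|\le c_A$.
   Context: $\mathbb X$ is a basic set (finite product of $\mathbb N$, $\mathbb Z$, $\Sigma^*$); the Min/Max versions concern $\mathbb N$-valued functions, so $x\in\mathbb N$ there. For a partial functional $F:\{0,1\}^*\times P(\mathbb N)\to\mathbb X$, $\mathcal K_F(x\,\|\,A)=\min\{|p|:F(p,A)=x\}$; $F$ is optimal in a family if for every $G$ in the family there is $c$ with $\mathcal K_F(x\|A)\le\mathcal K_G(x\|A)+c$ for all $x,A$. $PC$ = partial functionals computed by oracle Turing machines. For partial computable $\Phi$ with an extra argument $t\in\mathbb N$, $(\min\Phi)(p,A)=\min\{\Phi(p,A,t):\Phi(p,A,t)\text{ defined}\}$ and $\max\Phi$ analogously (undefined for the empty set, and max undefined for infinite sets); $Min_{PC},Max_{PC}$ are the families of such $\min\Phi,\max\Phi$.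 Oracular complexities: for a partial function $f:\{0,1\}^*\to\mathbb X$, $K_f(x)=\min\{|p|:f(p)=x\}$; $K^A=K_f$ for $f$ optimal (up to additive constants) among partial $A$-recursive functions $\{0,1\}^*\to\mathbb X$; $K^A_{\min}$ (resp. $K^A_{\max}$) $=K_f$ for $f$ optimal in $Min^A_{PR}$ (resp. $Max^A_{PR}$), the family of $\min\varphi$ (resp. $\max\varphi$) for partial $A$-recursive $\varphi:\{0,1\}^*\times\mathbb N\to\mathbb N$. -}

module Defs where

open import Level using (0ℓ)
open import Data.Bool using (Bool; true; false; if_then_else_)
open import Data.Nat using (ℕ; zero; suc; _+_; _*_; _≤_; _<_; _≥_; _/_)
open import Data.Integer using (ℤ; +_; -[1+_])
open import Data.Fin using (Fin; toℕ)
open import Data.Vec using (Vec; []; _∷_; lookup)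
open import Data.List using (List; []; _∷_; length)
open import Data.Product using (Σ; _×_; _,_; ∃)

-- Oracle model of computation: partial recursive (μ-recursive) functions
-- relative to an oracle A ⊆ ℕ, given by its characteristic function.
-- (Equivalent to oracle Turing machines.)

Oracle : Set
Oracle = ℕ → Bool

data PR : ℕ → Set where
  zro  : ∀ {n} → PR n
  succ : PR 1
  proj : ∀ {n} → Fin n → PR n
  orc  : PR 1
  comp : ∀ {m n} → PR m → Vec (PR n) m → PR n
  prec : ∀ {n} → PR n → PR (suc (suc n)) → PR (suc n)
  mu   : ∀ {n} → PR (suc n) → PR n

data Eval (A : Oracle) : ∀ {n} → PR n → Vec ℕ n → ℕ → Set
data EvalAll (A : Oracle) : ∀ {n m} → Vec (PR n) m → Vec ℕ n → Vec ℕ m → Set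

data Eval A where
  ezero : ∀ {n} {xs : Vec ℕ n} → Eval A zro xs 0
  esucc : ∀ {x} → Eval A succ (x ∷ []) (suc x)
  eproj : ∀ {n} {i : Fin n} {xs} → Eval A (proj i) xs (lookup xs i)
  eorc  : ∀ {x} → Eval A orc (x ∷ []) (if A x then 1 else 0)
  ecomp : ∀ {m n} {f : PR m} {gs : Vec (PR n) m} {xs ys y} →
          EvalAll A gs xs ys → Eval A f ys y → Eval A (comp f gs) xs y
  eprec0 : ∀ {n} {g : PR n} {h} {xs y} →
           Eval A g xs y → Eval A (prec g h) (0 ∷ xs) y
  eprecS : ∀ {n} {g : PR n} {h} {k xs r y} →
           Eval A (prec g h) (k ∷ xs) r → Eval A h (k ∷ r ∷ xs) y →
           Eval A (prec g h) (suc k ∷ xs) y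
  emu : ∀ {n} {f : PR (suc n)} {xs y} →
        Eval A f (y ∷ xs) 0 →
        (∀ i → i < y → Σ ℕ (λ k → Eval A f (i ∷ xs) (suc k))) →
        Eval A (mu f) xs y

data EvalAll A where
  [] : ∀ {n} {xs : Vec ℕ n} → EvalAll A [] xs []
  _∷_ : ∀ {n m} {g : PR n} {gs : Vec (PR n) m} {xs y ys} →
        Eval A g xs y → EvalAll A gs xs ys → EvalAll A (g ∷ gs) xs (y ∷ ys)

data BasicSet : Set where
  natS : BasicSet
  intS : BasicSet
  strS : ℕ → BasicSet
  _⊗_  : BasicSet → BasicSet → BasicSet

⟦_⟧ : BasicSet → Set
⟦ natS ⟧ = ℕ
⟦ intS ⟧ = ℤ
⟦ strS k ⟧ = List (Fin (suc k))
⟦ X ⊗ Y ⟧ = ⟦ X ⟧ × ⟦ Y ⟧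

-- standard computable injective (indeed bijective) encodings into ℕ
cantor : ℕ → ℕ → ℕ
cantor a b = ((a + b) * suc (a + b)) / 2 + b

encWord : ∀ k → List (Fin (suc k)) → ℕ
encWord k [] = 0
encWord k (a ∷ w) = suc (toℕ a) + suc k * encWord k w

encode : (X : BasicSet) → ⟦ X ⟧ → ℕ
encode natS n = n
encode intS (+ n) = 2 * n
encode intS -[1+ n ] = suc (2 * n)
encode (strS k) w = encWord k w
encode (X ⊗ Y) (x , y) = cantor (encode X x) (encode Y y)

-- binary programs p ∈ {0,1}*, coded bijectively in ℕ
bits : List Bool → ℕ
bits [] = 0
bits (false ∷ w) = 1 + 2 * bits w
bits (true ∷ w) = 2 + 2 * bits w

-- Partial functions / functionals, represented by their graphs.

PFun : Set → Set₁
PFun Y = List Bool → Y → Set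

PFunctional : Set → Set₁
PFunctional Y = List Bool → Oracle → Y → Set

-- PC({0,1}* × P(ℕ) → X): computed by one oracle machine, uniformly in A
PC : (X : BasicSet) → PFunctional ⟦ X ⟧ → Set
PC X F = Σ (PR 1) λ e → ∀ p A x →
  (F p A x → Eval A e (bits p ∷ []) (encode X x)) ×
  (Eval A e (bits p ∷ []) (encode X x) → F p A x)

IsMinOf : (ℕ → ℕ → Set) → ℕ → Set
IsMinOf R y = (Σ ℕ λ t → R t y) × (∀ t z → R t z → y ≤ z)

IsMaxOf : (ℕ → ℕ → Set) → ℕ → Set
IsMaxOf R y = (Σ ℕ λ t → R t y) × (∀ t z → R t z → z ≤ y)

_⇔'_ : Set → Set → Set
P ⇔' Q = (P → Q) × (Q → P)

MinPC : PFunctional ℕ → Set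
MinPC F = Σ (PR 2) λ e → ∀ p A y →
  F p A y ⇔' IsMinOf (λ t z → Eval A e (bits p ∷ t ∷ []) z) y

MaxPC : PFunctional ℕ → Set
MaxPC F = Σ (PR 2) λ e → ∀ p A y →
  F p A y ⇔' IsMaxOf (λ t z → Eval A e (bits p ∷ t ∷ []) z) y

PRA : Oracle → (X : BasicSet) → PFun ⟦ X ⟧ → Set
PRA A X f = Σ (PR 1) λ e → ∀ p x →
  f p x ⇔' Eval A e (bits p ∷ []) (encode X x)

MinPRA : Oracle → PFun ℕ → Set
MinPRA A f = Σ (PR 2) λ e → ∀ p y →
  f p y ⇔' IsMinOf (λ t z → Eval A e (bits p ∷ t ∷ []) z) y

MaxPRA : Oracle → PFun ℕ → Set
MaxPRA A f = Σ (PR 2) λ e → ∀ p y →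
  f p y ⇔' IsMaxOf (λ t z → Eval A e (bits p ∷ t ∷ []) z) y

-- Complexities, via their sublevel sets (values in ℕ ∪ {∞}):
--   KfLe f x n   ⟺  K_f(x) ≤ n        (K_f(x) = min{|p| : f(p)=x})
--   KFLe F x A n ⟺  𝒦_F(x‖A) ≤ n

KfLe : ∀ {Y} → PFun Y → Y → ℕ → Set
KfLe f x n = Σ (List Bool) λ p → (length p ≤ n) × f p x

KFLe : ∀ {Y} → PFunctional Y → Y → Oracle → ℕ → Set
KFLe F x A n = Σ (List Bool) λ p → (length p ≤ n) × F p A x

OptimalFunctional : ∀ {Y} → (PFunctional Y → Set) → PFunctional Y → Set₁
OptimalFunctional Fam F = Fam F × (∀ G → Fam G → Σ ℕ λ c →
  ∀ x A n → KFLe G x A n → KFLe F x A (n + c))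

OptimalFun : ∀ {Y} → (PFun Y → Set) → PFun Y → Set₁
OptimalFun Fam f = Fam f × (∀ g → Fam g → Σ ℕ λ c →
  ∀ x n → KfLe g x n → KfLe f x (n + c))

CloseWithin : ∀ {Y} → ℕ → PFun Y → PFunctional Y → Oracle → Y → Set
CloseWithin c f F A x =
  (∀ n → KfLe f x n → KFLe F x A (n + c)) ×
  (∀ n → KFLe F x A n → KfLe f x (n + c))

module Submission where

open import Defs
open import Data.Nat using (ℕ; _+_; _≤_; _⊔_)
open import Data.Nat.Properties using (≤-trans; +-monoʳ-≤; m≤m⊔n; m≤n⊔m)
open import Data.Product using (Σ; _×_; _,_; proj₁; proj₂)
open import Data.Vec using ([]; _∷_)
open import Function using (id)

-- A functional evaluated at the oracle A is an A-relative function, and conversely the machine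
-- computing an A-relative function, run on an arbitrary oracle, is a functional extending it.
-- Optimality absorbs each of the two translations in an additive constant.

-- KFLe F y A n unfolds to KfLe (F at A) y n, so lemmas about KfLe serve both complexities.
_at_ : ∀ {Y} → PFunctional Y → Oracle → PFun Y
(F at A) p y = F p A y

Specialises : ∀ {Y} → (PFunctional Y → Set) → (PFun Y → Set) → Oracle → Set₁
Specialises Fam Famᴬ A = ∀ F → Fam F → Famᴬ (F at A)

Uniformises : ∀ {Y} → (PFunctional Y → Set) → (PFun Y → Set) → Oracle → Set₁
Uniformises {Y} Fam Famᴬ A = ∀ g → Famᴬ g →
  Σ (PFunctional Y) λ G → Fam G × (∀ p y → g p y → G p A y)

KfLe-mono : ∀ {Y} (f : PFun Y) {y m n} → m ≤ n → KfLe f y m → KfLe f y n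
KfLe-mono f m≤n (p , |p|≤m , fpy) = p , ≤-trans |p|≤m m≤n , fpy

KfLe-⊆ : ∀ {Y} {f g : PFun Y} → (∀ p y → f p y → g p y) → ∀ y n → KfLe f y n → KfLe g y n
KfLe-⊆ f⊆g y n (p , |p|≤n , fpy) = p , |p|≤n , f⊆g p y fpy

CloseWithin-mono : ∀ {Y} {f : PFun Y} {F : PFunctional Y} {A y c d} → c ≤ d →
  CloseWithin c f F A y → CloseWithin d f F A y
CloseWithin-mono {f = f} {F} {A} c≤d (f→F , F→f) =
  (λ n k → KfLe-mono (F at A) (+-monoʳ-≤ n c≤d) (f→F n k)) ,
  (λ n k → KfLe-mono f (+-monoʳ-≤ n c≤d) (F→f n k))

optimal-close : ∀ {Y} {Fam : PFunctional Y → Set} {Famᴬ : PFun Y → Set} {A F f} →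
  Specialises Fam Famᴬ A → Uniformises Fam Famᴬ A →
  OptimalFunctional Fam F → OptimalFun Famᴬ f →
  Σ ℕ λ c → ∀ y → CloseWithin c f F A y
optimal-close {A = A} {F} {f} specialise uniformise (F∈Fam , optF) (f∈Famᴬ , optf) =
  let (G , G∈Fam , f⊆G) = uniformise f f∈Famᴬ
      (a , F-beats-G) = optF G G∈Fam
      (b , f-beats-FA) = optf (F at A) (specialise F F∈Fam)
  in a ⊔ b , λ y →
    (λ n k → KfLe-mono (F at A) (+-monoʳ-≤ n (m≤m⊔n a b))
               (F-beats-G y A n (KfLe-⊆ f⊆G y n k))) ,
    (λ n k → KfLe-mono f (+-monoʳ-≤ n (m≤n⊔m a b)) (f-beats-FA y n k))

computedBy : (X : BasicSet) → PR 1 → PFunctional ⟦ X ⟧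
computedBy X e p B x = Eval B e (bits p ∷ []) (encode X x)

minimumOf maximumOf : PR 2 → PFunctional ℕ
minimumOf e p B = IsMinOf (λ t z → Eval B e (bits p ∷ t ∷ []) z)
maximumOf e p B = IsMaxOf (λ t z → Eval B e (bits p ∷ t ∷ []) z)

PC-specialises : ∀ X A → Specialises (PC X) (PRA A X) A
PC-specialises X A F (e , spec) = e , λ p x → spec p A x

PC-uniformises : ∀ X A → Uniformises (PC X) (PRA A X) A
PC-uniformises X A g (e , spec) =
  computedBy X e , (e , λ _ _ _ → id , id) , λ p x → proj₁ (spec p x)

MinPC-specialises : ∀ A → Specialises MinPC (MinPRA A) A
MinPC-specialises A F (e , spec) = e , λ p y → spec p A y

MinPC-uniformises : ∀ A → Uniformises MinPC (MinPRA A) A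
MinPC-uniformises A g (e , spec) =
  minimumOf e , (e , λ _ _ _ → id , id) , λ p y → proj₁ (spec p y)

MaxPC-specialises : ∀ A → Specialises MaxPC (MaxPRA A) A
MaxPC-specialises A F (e , spec) = e , λ p y → spec p A y

MaxPC-uniformises : ∀ A → Uniformises MaxPC (MaxPRA A) A
MaxPC-uniformises A g (e , spec) =
  maximumOf e , (e , λ _ _ _ → id , id) , λ p y → proj₁ (spec p y)

mainTheorem5 : (X : BasicSet)
    (F : PFunctional ⟦ X ⟧) (Fmin Fmax : PFunctional ℕ) →
    OptimalFunctional (PC X) F →
    OptimalFunctional MinPC Fmin →
    OptimalFunctional MaxPC Fmax →
    (A : Oracle) →
    (f : PFun ⟦ X ⟧) (fmin fmax : PFun ℕ) →
    OptimalFun (PRA A X) f →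
    OptimalFun (MinPRA A) fmin →
    OptimalFun (MaxPRA A) fmax →
    Σ ℕ λ c →
    (∀ x → CloseWithin c f F A x) ×
    (∀ y → CloseWithin c fmin Fmin A y) ×
    (∀ y → CloseWithin c fmax Fmax A y)
mainTheorem5 X F Fmin Fmax optF optFmin optFmax A f fmin fmax optf optfmin optfmax =
  let (c₁ , close₁) = optimal-close (PC-specialises X A) (PC-uniformises X A) optF optf
      (c₂ , close₂) = optimal-close (MinPC-specialises A) (MinPC-uniformises A) optFmin optfmin
      (c₃ , close₃) = optimal-close (MaxPC-specialises A) (MaxPC-uniformises A) optFmax optfmax
  in c₁ ⊔ (c₂ ⊔ c₃) ,
     (λ x → CloseWithin-mono {f = f} {F} (m≤m⊔n c₁ _) (close₁ x)) ,
     (λ y → CloseWithin-mono {f = fmin} {Fmin} (≤-trans (m≤m⊔n c₂ c₃) (m≤n⊔m c₁ _)) (close₂ y)) ,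
     (λ y → CloseWithin-mono {f = fmax} {Fmax} (≤-trans (m≤n⊔m c₂ c₃) (m≤n⊔m c₁ _)) (close₃ y))
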